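{- Let $(G,\rho)$ be walk-independent. Then every two distinct vertices of $G$ are separated by an angle-preserving class (i.e., there is an angle-preserving class $r$ such that the two vertices lie in different connected components of $G$ with the edges of $r$ removed). In particular, each angle-preserving class is an edge cut.
   Context: All graphs are simple, undirected, connected and possibly countably infinite. A placement of $G$ is a map $\rho:V_G\to\mathbb{R}^2$ with $\rho(u)\neq\rho(v)$ for every edge $uv$. A parallelogram placement is an injective placement such that each induced 4-cycle of $G$ forms a non-degenerate parallelogram (vertices not all collinear). Angle-preserving classes: two edges are in relation $\triangle$ if they lie in a common 3-cycle subgraph of $G$, and in relation $\square$ if they are opposite edges of a 4-cycle subgraph of $G$; the angle-preserving classes are the equivalence classes of the reflexive-transitive closure of $\triangle\cup\square$ on $E_G$. $(G,\rho)$ is walk-independent if $\rho$ is a parallelogram placement and for every angle-preserving class $r$ and every closed walk $C=(u_1,\dots,u_k)$ in $G$ ($u_1=u_k$), $\sum(\rho(u_{i+1})-\rho(u_i))=(0,0)$, summing over all $1\le i<k$ with $u_iu_{i+1}\in r$. -}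

module Defs where

open import Level using (0ℓ)
open import Data.Nat using (ℕ)
open import Data.Unit using (⊤)
open import Data.Product using (Σ; _×_; _,_; ∃; ∃-syntax; proj₁; proj₂)
open import Data.Sum using (_⊎_)
open import Relation.Nullary using (¬_)
open import Relation.Binary.PropositionalEquality using (_≡_; _≢_)
open import Relation.Binary.Construct.Closure.ReflexiveTransitive using (Star)
open import Algebra.Bundles using (CommutativeRing)
open import Function.Definitions using (Injective)

record Field : Set₁ where
  field
    commRing : CommutativeRing 0ℓ 0ℓ
  open CommutativeRing commRing public
  field
    1≉0     : ¬ (1# ≈ 0#)
    inverse : ∀ x → ¬ (x ≈ 0#) → Σ Carrier λ y → (x * y) ≈ 1#

data Walk {V : Set} (Adj : V → V → Set) : V → V → Set where
  []  : ∀ {u} → Walk Adj u u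
  _∷_ : ∀ {u v w} → Adj u v → Walk Adj v w → Walk Adj u w

record Graph : Set₁ where
  field
    V          : Set
    Adj        : V → V → Set
    Adj-sym    : ∀ {u v} → Adj u v → Adj v u
    Adj-irrefl : ∀ {u} → ¬ Adj u u
    countable  : Σ (V → ℕ) (Injective _≡_ _≡_)
    connected  : ∀ u v → Walk Adj u v

module _ (G : Graph) where
  open Graph G

  -- an edge, given by its two endpoints (unordered: see _≅_)
  record Edge : Set where
    constructor edge
    field
      src : V
      tgt : V
      adj : Adj src tgt
  open Edge public

  _≅⟨_,_⟩ : Edge → V → V → Set
  e ≅⟨ a , b ⟩ = (src e ≡ a × tgt e ≡ b) ⊎ (src e ≡ b × tgt e ≡ a)

  OnTriangle : V → V → V → Edge → Set
  OnTriangle a b c e = e ≅⟨ a , b ⟩ ⊎ e ≅⟨ b , c ⟩ ⊎ e ≅⟨ c , a ⟩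

  Tri : Edge → Edge → Set
  Tri e f = Σ V λ a → Σ V λ b → Σ V λ c →
    (a ≢ b × b ≢ c × c ≢ a) ×
    (Adj a b × Adj b c × Adj c a) ×
    OnTriangle a b c e × OnTriangle a b c f

  Sq : Edge → Edge → Set
  Sq e f = Σ V λ a → Σ V λ b → Σ V λ c → Σ V λ d →
    (a ≢ b × a ≢ c × a ≢ d × b ≢ c × b ≢ d × c ≢ d) ×
    (Adj a b × Adj b c × Adj c d × Adj d a) ×
    e ≅⟨ a , b ⟩ × f ≅⟨ c , d ⟩

  SameEdge : Edge → Edge → Set
  SameEdge e f = e ≅⟨ src f , tgt f ⟩

  AngleRel : Edge → Edge → Set
  AngleRel = Star (λ e f → SameEdge e f ⊎ Tri e f ⊎ Sq e f)

  -- An angle-preserving class is represented by any of its edges r;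
  -- the edge e belongs to the class of r
  InClass : Edge → Edge → Set
  InClass r e = AngleRel r e

  Avoids : Edge → ∀ {x y} → Walk Adj x y → Set
  Avoids r []                    = ⊤
  Avoids r (_∷_ {u} {v} p w)     = ¬ InClass r (edge u v p) × Avoids r w

  Separated : Edge → V → V → Set
  Separated r x y = ¬ Σ (Walk Adj x y) (Avoids r)

module Placements (F : Field) (G : Graph) where
  open Field F
  open Graph G

  Point : Set
  Point = Carrier × Carrier

  _≈²_ : Point → Point → Set
  p ≈² q = (proj₁ p ≈ proj₁ q) × (proj₂ p ≈ proj₂ q)

  _-²_ : Point → Point → Point
  p -² q = (proj₁ p - proj₁ q) , (proj₂ p - proj₂ q)

  _+²_ : Point → Point → Point
  p +² q = (proj₁ p + proj₁ q) , (proj₂ p + proj₂ q)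

  0² : Point
  0² = 0# , 0#

  Collinear3 : Point → Point → Point → Set
  Collinear3 p q r =
    (proj₁ (q -² p) * proj₂ (r -² p)) - (proj₂ (q -² p) * proj₁ (r -² p)) ≈ 0#

  AllCollinear : Point → Point → Point → Point → Set
  AllCollinear p q r s =
    Collinear3 p q r × Collinear3 p q s × Collinear3 p r s × Collinear3 q r s

  Induced4Cycle : V → V → V → V → Set
  Induced4Cycle a b c d =
    (a ≢ b × a ≢ c × a ≢ d × b ≢ c × b ≢ d × c ≢ d) ×
    (Adj a b × Adj b c × Adj c d × Adj d a) ×
    (¬ Adj a c × ¬ Adj b d)

  ParallelogramPlacement : (V → Point) → Set
  ParallelogramPlacement ρ =
    (∀ u v → ρ u ≈² ρ v → u ≡ v) ×
    (∀ a b c d → Induced4Cycle a b c d →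
       ((ρ b -² ρ a) ≈² (ρ c -² ρ d)) ×
       ¬ AllCollinear (ρ a) (ρ b) (ρ c) (ρ d))

  data ClassSum (ρ : V → Point) (r : Edge G) :
       ∀ {x y} → Walk Adj x y → Point → Set where
    nil  : ∀ {x} → ClassSum ρ r ([] {u = x}) 0²
    cin  : ∀ {u v y} {p : Adj u v} {w : Walk Adj v y} {s} →
           InClass G r (edge u v p) → ClassSum ρ r w s →
           ClassSum ρ r (p ∷ w) ((ρ v -² ρ u) +² s)
    cout : ∀ {u v y} {p : Adj u v} {w : Walk Adj v y} {s} →
           ¬ InClass G r (edge u v p) → ClassSum ρ r w s →
           ClassSum ρ r (p ∷ w) s

  WalkIndependent : (V → Point) → Set
  WalkIndependent ρ =
    ParallelogramPlacement ρ ×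
    (∀ (r : Edge G) {x} (w : Walk Adj x x) s → ClassSum ρ r w s → s ≈² 0²)

{-# OPTIONS --safe #-}
-- For an angle-preserving class r, the r-part of the displacement along a walk
-- (the sum of ρ(v) − ρ(u) over its steps uv in r) depends only on the endpoints:
-- walk-independence applied to w followed by the reverse of v makes the r-parts
-- of w and v equal.  It vanishes along a walk avoiding r.  So if no class
-- separated x from y, every class would contribute 0 along a fixed walk from x to
-- y; grouping the steps of that walk by class, ρ(y) − ρ(x) = 0 and x = y by
-- injectivity.  For an edge r = uv the one-step walk has r-part ρ(v) − ρ(u) ≠ 0,
-- so no walk from u to v avoids the class of r.  Excluded middle decides class
-- membership and turns non-separation into avoiding walks.

module Submission where

open import Defs
open import Level using (0ℓ)
open import Axiom.ExcludedMiddle using (ExcludedMiddle)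
open import Algebra.Bundles using (CommutativeMonoid; AbelianGroup)
open import Algebra.Construct.DirectProduct using (abelianGroup)
import Algebra.Properties.AbelianGroup as AbelianGroupProperties
import Algebra.Properties.CommutativeSemigroup as CommutativeSemigroupProperties
open import Data.Empty using (⊥-elim)
open import Data.List using (List; []; _∷_; _++_)
open import Data.List.Membership.Propositional using (_∈_)
open import Data.List.Relation.Unary.All as All using (All; []; _∷_)
open import Data.List.Relation.Unary.Any using (here; there)
open import Data.List.Relation.Unary.Any.Properties using (¬Any[])
open import Data.Product using (Σ; _×_; _,_; proj₁; proj₂)
open import Data.Sum using (_⊎_; inj₁; inj₂)
open import Function using (id)
import Relation.Binary.Construct.Closure.ReflexiveTransitive as Star
open import Relation.Binary.PropositionalEquality as ≡ using (_≡_; _≢_; ≢-sym)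
import Relation.Binary.Reasoning.Setoid as SetoidReasoning
open import Relation.Nullary using (¬_; yes; no)
open import Relation.Nullary.Decidable using (decidable-stable)
open import Relation.Unary using (Pred; Decidable; _⊆_; _≐_; _∩_; ∁; U)
open import Relation.Unary.Properties using (U?; _∩?_; ∁?)

module _ {V : Set} {Adj : V → V → Set} where

  infixr 5 _++ʷ_

  _++ʷ_ : ∀ {x y z} → Walk Adj x y → Walk Adj y z → Walk Adj x z
  []      ++ʷ v = v
  (p ∷ w) ++ʷ v = p ∷ (w ++ʷ v)

  reverseʷ : (∀ {u v} → Adj u v → Adj v u) → ∀ {x y} → Walk Adj x y → Walk Adj y x
  reverseʷ Adj-sym []      = []
  reverseʷ Adj-sym (p ∷ w) = reverseʷ Adj-sym w ++ʷ (Adj-sym p ∷ [])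

module _ {a ℓ} (H : AbelianGroup a ℓ) where
  open AbelianGroup H
  open SetoidReasoning setoid

  telescope : ∀ x y z → (y - x) ∙ (z - y) ≈ z - x
  telescope x y z = begin
    (y ∙ x ⁻¹) ∙ (z ∙ y ⁻¹)   ≈⟨ comm _ _ ⟩
    (z ∙ y ⁻¹) ∙ (y ∙ x ⁻¹)   ≈⟨ assoc _ _ _ ⟩
    z ∙ (y ⁻¹ ∙ (y ∙ x ⁻¹))   ≈⟨ ∙-congˡ (sym (assoc _ _ _)) ⟩
    z ∙ ((y ⁻¹ ∙ y) ∙ x ⁻¹)   ≈⟨ ∙-congˡ (∙-congʳ (inverseˡ y)) ⟩
    z ∙ (ε ∙ x ⁻¹)            ≈⟨ ∙-congˡ (identityˡ _) ⟩
    z ∙ x ⁻¹                  ∎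

module FilteredSum {c ℓ a} (M : CommutativeMonoid c ℓ) {A : Set a}
                   (f : A → CommutativeMonoid.Carrier M) where
  open CommutativeMonoid M
  open CommutativeSemigroupProperties commutativeSemigroup using (x∙yz≈y∙xz)

  sumWhere : ∀ {p} {P : Pred A p} → Decidable P → List A → Carrier
  sumWhere P? []       = ε
  sumWhere P? (x ∷ xs) with P? x
  ... | yes _ = f x ∙ sumWhere P? xs
  ... | no  _ = sumWhere P? xs

  module _ {p} {P : Pred A p} (P? : Decidable P) where

    sumWhere-++ : ∀ xs ys → sumWhere P? (xs ++ ys) ≈ sumWhere P? xs ∙ sumWhere P? ys
    sumWhere-++ []       ys = sym (identityˡ _)
    sumWhere-++ (x ∷ xs) ys with P? x
    ... | yes _ = trans (∙-congˡ (sumWhere-++ xs ys)) (sym (assoc _ _ _))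
    ... | no  _ = sumWhere-++ xs ys

    sumWhere-none : ∀ {xs} → All (∁ P) xs → sumWhere P? xs ≈ ε
    sumWhere-none {[]}     []          = refl
    sumWhere-none {x ∷ xs} (¬Px ∷ ¬Ps) with P? x
    ... | yes Px = ⊥-elim (¬Px Px)
    ... | no  _  = sumWhere-none ¬Ps

    sumWhere-split : ∀ {q r} {Q : Pred A q} {R : Pred A r} (Q? : Decidable Q) (R? : Decidable R) →
                     Q ⊆ P → R ≐ P ∩ ∁ Q →
                     ∀ xs → sumWhere P? xs ≈ sumWhere Q? xs ∙ sumWhere R? xs
    sumWhere-split Q? R? Q⊆P R≐P∖Q [] = sym (identityˡ ε)
    sumWhere-split Q? R? Q⊆P R≐P∖Q@(R⊆P∖Q , P∖Q⊆R) (x ∷ xs)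
      with sumWhere-split Q? R? Q⊆P R≐P∖Q xs | P? x | Q? x | R? x
    ... | ih | yes _  | yes _  | no  _  = trans (∙-congˡ ih) (sym (assoc _ _ _))
    ... | ih | yes _  | no  _  | yes _  = trans (∙-congˡ ih) (x∙yz≈y∙xz _ _ _)
    ... | ih | no  _  | no  _  | no  _  = ih
    ... | _  | _      | yes Qx | yes Rx = ⊥-elim (proj₂ (R⊆P∖Q Rx) Qx)
    ... | _  | yes Px | no ¬Qx | no ¬Rx = ⊥-elim (¬Rx (P∖Q⊆R (Px , ¬Qx)))
    ... | _  | no ¬Px | yes Qx | _      = ⊥-elim (¬Px (Q⊆P Qx))
    ... | _  | no ¬Px | _      | yes Rx = ⊥-elim (¬Px (proj₁ (R⊆P∖Q Rx)))

module _ (G : Graph) where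

  SameEdge-sym : ∀ {e f} → SameEdge G e f → SameEdge G f e
  SameEdge-sym (inj₁ (s≡s , t≡t)) = inj₁ (≡.sym s≡s , ≡.sym t≡t)
  SameEdge-sym (inj₂ (s≡t , t≡s)) = inj₂ (≡.sym t≡s , ≡.sym s≡t)

  Sq-sym : ∀ {e f} → Sq G e f → Sq G f e
  Sq-sym (a , b , c , d , (a≢b , a≢c , a≢d , b≢c , b≢d , c≢d) , (ab , bc , cd , da) , e≅ab , f≅cd) =
    c , d , a , b ,
    (c≢d , ≢-sym a≢c , ≢-sym b≢c , ≢-sym a≢d , ≢-sym b≢d , a≢b) ,
    (cd , da , ab , bc) , f≅cd , e≅ab

  AngleRel-sym : ∀ {e f} → AngleRel G e f → AngleRel G f e
  AngleRel-sym = Star.reverse (λ {e} {f} → step-sym {e} {f})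
    where
    step-sym : ∀ {e f} → SameEdge G e f ⊎ Tri G e f ⊎ Sq G e f →
                         SameEdge G f e ⊎ Tri G f e ⊎ Sq G f e
    step-sym {e} {f} (inj₁ e≅f) = inj₁ (SameEdge-sym {e} {f} e≅f)
    step-sym (inj₂ (inj₁ (a , b , c , distinct , adj , e∈abc , f∈abc))) =
      inj₂ (inj₁ (a , b , c , distinct , adj , f∈abc , e∈abc))
    step-sym {e} {f} (inj₂ (inj₂ sq)) = inj₂ (inj₂ (Sq-sym {e} {f} sq))

  ClassClosed : ∀ {p} → Pred (Edge G) p → Set p
  ClassClosed P = ∀ {e f} → P e → AngleRel G e f → P f

  ∖InClass-closed : ∀ {p} {P : Pred (Edge G) p} r →
                    ClassClosed P → ClassClosed (P ∩ ∁ (InClass G r))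
  ∖InClass-closed r P-closed (Pe , r≁e) e~f =
    P-closed Pe e~f , λ r~f → r≁e (r~f Star.◅◅ AngleRel-sym e~f)

  InClass-reversed : ∀ {r u v} {p : Graph.Adj G u v} {q : Graph.Adj G v u} →
                     InClass G r (edge u v p) → InClass G r (edge v u q)
  InClass-reversed r~p = r~p Star.◅◅ (inj₁ (inj₂ (≡.refl , ≡.refl)) Star.◅ Star.ε)

module ClassSums (em : ExcludedMiddle 0ℓ) (F : Field) (G : Graph)
                 (ρ : Graph.V G → Placements.Point F G) where
  open Graph G
  open Placements F G

  plane : AbelianGroup 0ℓ 0ℓ
  plane = abelianGroup (Field.+-abelianGroup F) (Field.+-abelianGroup F)

  open AbelianGroup plane
    using ( ε; _∙_; _⁻¹; _≈_; setoid; sym; trans; ∙-cong; ∙-congˡ; ⁻¹-cong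
          ; comm; identityˡ; identityʳ; inverseʳ )
  open AbelianGroupProperties plane using (ε⁻¹≈ε; ⁻¹-anti-homo‿-; ⁻¹-∙-comm; x∙y⁻¹≈ε⇒x≈y)
  open SetoidReasoning setoid

  δ : Edge G → Point
  δ e = ρ (tgt e) -² ρ (src e)

  open FilteredSum (AbelianGroup.commutativeMonoid plane) δ

  edges : ∀ {x y} → Walk Adj x y → List (Edge G)
  edges []      = []
  edges (p ∷ w) = edge _ _ p ∷ edges w

  edges-++ : ∀ {x y z} (w : Walk Adj x y) (v : Walk Adj y z) →
             edges (w ++ʷ v) ≡ edges w ++ edges v
  edges-++ []      v = ≡.refl
  edges-++ (p ∷ w) v = ≡.cong (edge _ _ p ∷_) (edges-++ w v)

  inClass? : ∀ r → Decidable (InClass G r)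
  inClass? r e = em

  classSum : Edge G → ∀ {x y} → Walk Adj x y → Point
  classSum r w = sumWhere (inClass? r) (edges w)

  classSum-sound : ∀ r {x y} (w : Walk Adj x y) → ClassSum ρ r w (classSum r w)
  classSum-sound r []      = nil
  classSum-sound r (p ∷ w) with inClass? r (edge _ _ p)
  ... | yes r~p = cin r~p (classSum-sound r w)
  ... | no  r≁p = cout r≁p (classSum-sound r w)

  classSum-++ : ∀ r {x y z} (w : Walk Adj x y) (v : Walk Adj y z) →
                classSum r (w ++ʷ v) ≈ classSum r w ∙ classSum r v
  classSum-++ r w v rewrite edges-++ w v = sumWhere-++ (inClass? r) (edges w) (edges v)

  reverse : ∀ {x y} → Walk Adj x y → Walk Adj y x
  reverse = reverseʷ Adj-sym

  classSum-reverse-edge : ∀ r {u v} (p : Adj u v) →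
                          classSum r (Adj-sym p ∷ []) ≈ classSum r (p ∷ []) ⁻¹
  classSum-reverse-edge r {u} {v} p
    with inClass? r (edge u v p) | inClass? r (edge v u (Adj-sym p))
  ... | yes _   | yes _   = begin
    (ρ u -² ρ v) ∙ ε     ≈⟨ identityʳ _ ⟩
    ρ u -² ρ v           ≈⟨ sym (⁻¹-anti-homo‿- (ρ v) (ρ u)) ⟩
    (ρ v -² ρ u) ⁻¹      ≈⟨ ⁻¹-cong (sym (identityʳ _)) ⟩
    ((ρ v -² ρ u) ∙ ε) ⁻¹ ∎
  ... | no  _   | no  _   = sym ε⁻¹≈ε
  ... | yes r~p | no  r≁q = ⊥-elim (r≁q (InClass-reversed G r~p))
  ... | no  r≁p | yes r~q = ⊥-elim (r≁p (InClass-reversed G r~q))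

  classSum-reverse : ∀ r {x y} (w : Walk Adj x y) → classSum r (reverse w) ≈ classSum r w ⁻¹
  classSum-reverse r []      = sym ε⁻¹≈ε
  classSum-reverse r (p ∷ w) = begin
    classSum r (reverse w ++ʷ p⁻)               ≈⟨ classSum-++ r (reverse w) p⁻ ⟩
    classSum r (reverse w) ∙ classSum r p⁻      ≈⟨ ∙-cong (classSum-reverse r w) (classSum-reverse-edge r p) ⟩
    classSum r w ⁻¹ ∙ classSum r p⁺ ⁻¹          ≈⟨ ⁻¹-∙-comm _ _ ⟩
    (classSum r w ∙ classSum r p⁺) ⁻¹           ≈⟨ ⁻¹-cong (comm _ _) ⟩
    (classSum r p⁺ ∙ classSum r w) ⁻¹           ≈⟨ ⁻¹-cong (sym (classSum-++ r p⁺ w)) ⟩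
    classSum r (p ∷ w) ⁻¹                       ∎
    where
    p⁺ = p ∷ []
    p⁻ = Adj-sym p ∷ []

  classSum-avoiding : ∀ r {x y} (w : Walk Adj x y) → Avoids G r w → classSum r w ≈ ε
  classSum-avoiding r w w-avoids = sumWhere-none (inClass? r) (edges-avoid w w-avoids)
    where
    edges-avoid : ∀ {x y} (w : Walk Adj x y) → Avoids G r w → All (∁ (InClass G r)) (edges w)
    edges-avoid []      _             = []
    edges-avoid (p ∷ w) (r≁p , avoids) = r≁p ∷ edges-avoid w avoids

  classSum-own-edge : ∀ r → classSum r (adj r ∷ []) ≈ δ r
  classSum-own-edge r with inClass? r (edge (src r) (tgt r) (adj r))
  ... | yes _   = identityʳ _
  ... | no  r≁r = ⊥-elim (r≁r Star.ε)

  displacement : ∀ {x y} (w : Walk Adj x y) → sumWhere U? (edges w) ≈ ρ y -² ρ x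
  displacement {x} []      = sym (inverseʳ (ρ x))
  displacement (p ∷ w) = trans (∙-congˡ (displacement w)) (telescope plane _ _ _)

  -- Peel off one class at a time: the P-edges of xs split into the class of p,
  -- which sums to zero, and the rest, which is again a union of classes.
  module _ (xs : List (Edge G)) (balanced : ∀ r → sumWhere (inClass? r) xs ≈ ε) where

    sumWhere-classClosed : ∀ s {P : Pred (Edge G) 0ℓ} (P? : Decidable P) → ClassClosed G P →
                           (∀ {e} → e ∈ xs → P e → e ∈ s) →
                           sumWhere P? xs ≈ ε
    sumWhere-classClosed [] P? _ covered =
      sumWhere-none P? (All.tabulate λ e∈xs Pe → ¬Any[] (covered e∈xs Pe))
    sumWhere-classClosed (p ∷ s) {P} P? closed covered with P? p
    ... | no ¬Pp = sumWhere-classClosed s P? closed covered′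
      where
      covered′ : ∀ {e} → e ∈ xs → P e → e ∈ s
      covered′ e∈xs Pe with covered e∈xs Pe
      ... | here ≡.refl = ⊥-elim (¬Pp Pe)
      ... | there e∈s   = e∈s
    ... | yes Pp = begin
      sumWhere P? xs                               ≈⟨ sumWhere-split P? (inClass? p) P∖p? p~⊆P (id , id) xs ⟩
      sumWhere (inClass? p) xs ∙ sumWhere P∖p? xs  ≈⟨ ∙-cong (balanced p) P∖p-sum ⟩
      ε ∙ ε                                        ≈⟨ identityˡ ε ⟩
      ε                                            ∎
      where
      p~⊆P : InClass G p ⊆ P
      p~⊆P p~e = closed Pp p~e
      P∖p? : Decidable (P ∩ ∁ (InClass G p))
      P∖p? = P? ∩? ∁? (inClass? p)
      covered′ : ∀ {e} → e ∈ xs → P e × ¬ InClass G p e → e ∈ s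
      covered′ e∈xs (Pe , p≁e) with covered e∈xs Pe
      ... | here ≡.refl = ⊥-elim (p≁e Star.ε)
      ... | there e∈s   = e∈s
      P∖p-sum : sumWhere P∖p? xs ≈ ε
      P∖p-sum = sumWhere-classClosed s P∖p? (∖InClass-closed G p closed) covered′

  module Separation (WI : WalkIndependent ρ) where

    difference-zero⇒≡ : ∀ {u v} → ρ u -² ρ v ≈ ε → u ≡ v
    difference-zero⇒≡ ρu-ρv≈0 = proj₁ (proj₁ WI) _ _ (x∙y⁻¹≈ε⇒x≈y _ _ ρu-ρv≈0)

    classSum-path-independent : ∀ r {x y} (w v : Walk Adj x y) → classSum r w ≈ classSum r v
    classSum-path-independent r w v = x∙y⁻¹≈ε⇒x≈y _ _ (begin
      classSum r w ∙ classSum r v ⁻¹         ≈⟨ ∙-congˡ (sym (classSum-reverse r v)) ⟩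
      classSum r w ∙ classSum r (reverse v)  ≈⟨ sym (classSum-++ r w (reverse v)) ⟩
      classSum r (w ++ʷ reverse v)           ≈⟨ proj₂ WI r (w ++ʷ reverse v) _ (classSum-sound r _) ⟩
      ε                                      ∎)

    edge-separates-endpoints : ∀ r → Separated G r (src r) (tgt r)
    edge-separates-endpoints r (v , v-avoids) = Adj-irrefl (≡.subst (Adj (src r)) tgt≡src (adj r))
      where
      tgt≡src : tgt r ≡ src r
      tgt≡src = difference-zero⇒≡ (begin
        δ r                     ≈⟨ sym (classSum-own-edge r) ⟩
        classSum r (adj r ∷ []) ≈⟨ classSum-path-independent r (adj r ∷ []) v ⟩
        classSum r v            ≈⟨ classSum-avoiding r v v-avoids ⟩
        ε                       ∎)

    unseparated⇒≡ : ∀ {x y} → (∀ r → Σ (Walk Adj x y) (Avoids G r)) → x ≡ y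
    unseparated⇒≡ {x} {y} avoiding = ≡.sym (difference-zero⇒≡ (begin
      ρ y -² ρ x            ≈⟨ sym (displacement w) ⟩
      sumWhere U? (edges w) ≈⟨ sumWhere-classClosed (edges w) balanced (edges w) U? _ (λ e∈w _ → e∈w) ⟩
      ε                     ∎))
      where
      w : Walk Adj x y
      w = connected x y
      balanced : ∀ r → classSum r w ≈ ε
      balanced r = trans (classSum-path-independent r w (proj₁ (avoiding r)))
                         (classSum-avoiding r _ (proj₂ (avoiding r)))

    separating-class : ∀ {x y} → x ≢ y → Σ (Edge G) λ r → Separated G r x y
    separating-class x≢y = decidable-stable em λ no-class →
      x≢y (unseparated⇒≡ λ r → decidable-stable em λ separates → no-class (r , separates))

lemma1p5 : ExcludedMiddle 0ℓ → (F : Field) (G : Graph)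
    (ρ : Graph.V G → Placements.Point F G) →
    Placements.WalkIndependent F G ρ →
    (∀ (x y : Graph.V G) → x ≢ y → Σ (Edge G) λ r → Separated G r x y) ×
    (∀ (r : Edge G) → Σ (Graph.V G) λ x → Σ (Graph.V G) λ y → Separated G r x y)
lemma1p5 em F G ρ WI = (λ _ _ → separating-class) , λ r → src r , tgt r , edge-separates-endpoints r
  where open ClassSums.Separation em F G ρ WI
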